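{- Let $\ell\geqslant 2$, $\varepsilon\in\{+1,-1\}$, $K\subset[1,\ell-1]$ and $K'=[1,\ell-1]\setminus K$. Then $$a_\ell^{(\varepsilon)}(K)+a_\ell^{(\varepsilon)}(K')=\tfrac13\ell(\ell-1)\big(\ell+\tfrac{1-3\varepsilon}{4}\big)\quad\text{and}\quad q^{\frac{\ell(\ell-1)}{2}}\,w_{\ell,K}(q^{ -1})=w_{\ell,K'}(q).$$
   Context: $[m,n]=\{x\in\mathbb Z\mid m\le x\le n\}$. $\varphi_i(q)=\prod_{j=1}^i(q^j-1)$ ($\varphi_0=1$). For $I=\{i_1<\dots<i_r\}\subset[1,\ell-1]$, with $i_0=0$, $i_{r+1}=\ell$, $\varphi_{(I)}(q)=\varphi_\ell(q)/\prod_{\nu=0}^{r}\varphi_{i_{\nu+1}-i_\nu}(q)$. For $K\subset[1,\ell-1]$: $w_{\ell,K}(q)=\sum_{I\subset K}(-1)^{\#(K\setminus I)}\varphi_{(I)}(q)$ and $a_\ell^{(\varepsilon)}(K)=\sum_{i\in K}\big(\frac{\ell(\ell-\varepsilon)}{2}-\frac{i(i-\varepsilon)}{2}\big)$. -}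

module Defs where

open import Data.Nat as ℕ using (ℕ; zero; suc)
open import Data.Integer as ℤ using (ℤ; +_)
open import Data.Rational as ℚ using (ℚ; 0ℚ; 1ℚ; _+_; _*_; _-_; -_; _÷_)
open import Data.Rational.Properties using (_≟_)
open import Data.Bool using (Bool; true; false)
open import Data.Vec using (Vec; []; _∷_)
open import Data.List using (List; []; _∷_; map; _++_; foldr)
open import Data.Fin.Subset using (Subset; ∣_∣; _─_)
open import Relation.Nullary using (yes; no)

pow : ℚ → ℕ → ℚ
pow q zero    = 1ℚ
pow q (suc n) = q * pow q n

sumℚ : List ℚ → ℚ
sumℚ = foldr _+_ 0ℚ

prodℚ : List ℚ → ℚ
prodℚ = foldr _*_ 1ℚ

-- total division on ℚ (x / 0 := 0); only ever used with nonzero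
-- denominators under the hypotheses of the statement
_⊘_ : ℚ → ℚ → ℚ
p ⊘ q with q ≟ 0ℚ
... | yes _ = 0ℚ
... | no q≢0 = _÷_ p q {{ℚ.≢-nonZero q≢0}}

-- A subset K of [1, ℓ-1] is a  Subset (ℓ ∸ 1) : position j (0-based)
-- stands for the integer j+1.

φ : ℕ → ℚ → ℚ
φ zero    q = 1ℚ
φ (suc i) q = (pow q (suc i) - 1ℚ) * φ i q

-- the gaps i_{ν+1} - i_ν (ν = 0..r) of I = {i_1 < … < i_r}, with
-- i_0 = 0 and i_{r+1} = n+1 (= ℓ); c counts the current run
gaps : ℕ → {n : ℕ} → Subset n → List ℕ
gaps c []            = suc c ∷ []
gaps c (true  ∷ s)   = suc c ∷ gaps 0 s
gaps c (false ∷ s)   = gaps (suc c) s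

φ₍₎ : (ℓ : ℕ) → Subset (ℓ ℕ.∸ 1) → ℚ → ℚ
φ₍₎ ℓ I q = φ ℓ q ⊘ prodℚ (map (λ d → φ d q) (gaps 0 I))

subsetsOf : {n : ℕ} → Subset n → List (Subset n)
subsetsOf []          = [] ∷ []
subsetsOf (true ∷ K)  = map (true ∷_) (subsetsOf K) ++ map (false ∷_) (subsetsOf K)
subsetsOf (false ∷ K) = map (false ∷_) (subsetsOf K)

sgn : ℕ → ℚ
sgn zero    = 1ℚ
sgn (suc k) = - sgn k

w : (ℓ : ℕ) → Subset (ℓ ℕ.∸ 1) → ℚ → ℚ
w ℓ K q = sumℚ (map (λ I → sgn ∣ K ─ I ∣ * φ₍₎ ℓ I q) (subsetsOf K))

-- the elements of a subset, as integers (offset o: position j ↦ o+j+1)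
elems : ℕ → {n : ℕ} → Subset n → List ℕ
elems o []          = []
elems o (true ∷ s)  = suc o ∷ elems (suc o) s
elems o (false ∷ s) = elems (suc o) s

tri : ℤ → ℕ → ℚ
tri ε x = ((+ x) ℤ.* ((+ x) ℤ.- ε)) ℚ./ 2

a : (ℓ : ℕ) → ℤ → Subset (ℓ ℕ.∸ 1) → ℚ
a ℓ ε K = sumℚ (map (λ i → tri ε ℓ - tri ε i) (elems 0 K))

{-# OPTIONS --safe #-}

-- The first identity is a telescoping sum: a(K) + a(K′) runs over all i ∈ [1, ℓ-1], and
-- Σ_{i=1}^{n} i(i-ε)/2 = n(n+1)(2n+1-3ε)/12.
--
-- For the second, expanding the sum over I ⊆ K along the elements of K gives a recursion Ψ_s(K)
-- in which only the sequence s_n = 1/φ_n(q) enters, and w_{ℓ,K}(q) = φ_ℓ(q) Ψ_s(K). The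
-- q-identity Ψ_s([1,k]) = t_{k+1}, where t_n = q^{n(n-1)/2}/φ_n(q), turns the recursion for Ψ_t
-- into the one for Ψ_s with K replaced by its complement: Ψ_t(K) = Ψ_s(K′). Finally
-- 1/φ_n(1/q) = (-q)^n t_n and, for K ⊆ [1, ℓ-1], Ψ_{(a^n s_n)}(K) = a^ℓ Ψ_s(K), so that
-- q^{ℓ(ℓ-1)/2} w_{ℓ,K}(1/q) = q^{ℓ(ℓ-1)/2} φ_ℓ(1/q) (-q)^ℓ Ψ_s(K′) = φ_ℓ(q) Ψ_s(K′) = w_{ℓ,K′}(q).
module Submission where

open import Defs
open import Data.Nat using (ℕ; _≤_; _∸_) renaming (_*_ to _*ℕ_; _/_ to _div_)
open import Data.Integer using (ℤ; +_; -[1+_]) renaming (_-_ to _-ℤ_; _*_ to _*ℤ_)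
open import Data.Rational using (ℚ; 0ℚ; 1ℚ; -_; _+_; _*_; _-_; _/_)
open import Data.Fin.Subset using (Subset; ∁)
open import Data.Product using (_×_)
open import Data.Sum using (_⊎_)
open import Relation.Binary.PropositionalEquality using (_≡_; _≢_)

open import Algebra.Bundles using (CommutativeMonoid)
open import Data.Bool using (Bool; true; false; not)
open import Data.Fin.Subset using (⊤; _─_; ∣_∣)
open import Data.List using (List; []; _∷_; map; _++_; replicate; length)
open import Data.List.Properties using (map-∘; map-cong; ++-identityʳ)
open import Data.Nat using (zero; suc)
open import Data.Nat.DivMod using (m*n/n≡m)
open import Data.Product using (_,_)
open import Data.Sum using (inj₁; inj₂)
open import Data.Vec using ([]; _∷_; toList)
open import Data.Vec.Properties using (toList-map; length-toList)
open import Function using (_∘_)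
open import Level using (0ℓ)
open import Relation.Binary.Definitions using (tri<; tri≈; tri>)
open import Relation.Binary.PropositionalEquality using (refl; sym; trans; cong; cong₂; subst; module ≡-Reasoning)
open import Relation.Nullary using (Dec; yes; no)
open import Relation.Nullary.Decidable.Core using (dec⇒maybe)
open import Relation.Nullary.Negation using (contradiction)
open import Tactic.RingSolver using (solve-∀)
open import Tactic.RingSolver.Core.AlmostCommutativeRing using (AlmostCommutativeRing; fromCommutativeRing)
import Algebra.Properties.CommutativeSemigroup as CommSemigroupProperties
import Algebra.Properties.Group as GroupProperties
import Data.Integer as ℤ
import Data.Integer.Properties as ℤP
import Data.Integer.Tactic.RingSolver as ℤ-Solver
import Data.Nat as ℕ
import Data.Nat.Coprimality as Coprimality
import Data.Nat.Properties as ℕP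
import Data.Rational as ℚ
import Data.Rational.Properties as ℚP

ℚ-ring : AlmostCommutativeRing 0ℓ 0ℓ
ℚ-ring = fromCommutativeRing ℚP.+-*-commutativeRing (λ x → dec⇒maybe (0ℚ ℚP.≟ x))

pow-+ : ∀ a m n → pow a (m ℕ.+ n) ≡ pow a m * pow a n
pow-+ a zero    n = sym (ℚP.*-identityˡ _)
pow-+ a (suc m) n = trans (cong (a *_) (pow-+ a m n)) (sym (ℚP.*-assoc a _ _))

module _ (α : ℚ) .{{_ : ℚ.NonNegative α}} where
  open ℚP.≤-Reasoning

  pow≤1 : α ℚ.≤ 1ℚ → ∀ n → pow α n ℚ.≤ 1ℚ
  pow≤1 α≤1 zero    = ℚP.≤-refl
  pow≤1 α≤1 (suc n) = begin
    α * pow α n  ≤⟨ ℚP.*-monoˡ-≤-nonNeg α (pow≤1 α≤1 n) ⟩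
    α * 1ℚ       ≡⟨ ℚP.*-identityʳ α ⟩
    α            ≤⟨ α≤1 ⟩
    1ℚ           ∎

  1≤pow : 1ℚ ℚ.≤ α → ∀ n → 1ℚ ℚ.≤ pow α n
  1≤pow 1≤α zero    = ℚP.≤-refl
  1≤pow 1≤α (suc n) = begin
    1ℚ           ≤⟨ 1≤α ⟩
    α            ≡⟨ ℚP.*-identityʳ α ⟨
    α * 1ℚ       ≤⟨ ℚP.*-monoˡ-≤-nonNeg α (1≤pow 1≤α n) ⟩
    α * pow α n  ∎

  pow-suc≢1-nonNeg : α ≢ 1ℚ → ∀ j → pow α (suc j) ≢ 1ℚ
  pow-suc≢1-nonNeg α≢1 j αʲ⁺¹≡1 with ℚP.<-cmp α 1ℚ
  ... | tri< α<1 _ _ = ℚP.<-irrefl αʲ⁺¹≡1 (begin-strict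
    α * pow α j  ≤⟨ ℚP.*-monoˡ-≤-nonNeg α (pow≤1 (ℚP.<⇒≤ α<1) j) ⟩
    α * 1ℚ       ≡⟨ ℚP.*-identityʳ α ⟩
    α            <⟨ α<1 ⟩
    1ℚ           ∎)
  ... | tri≈ _ α≡1 _ = α≢1 α≡1
  ... | tri> _ _ α>1 = ℚP.<-irrefl (sym αʲ⁺¹≡1) (begin-strict
    1ℚ           <⟨ α>1 ⟩
    α            ≡⟨ ℚP.*-identityʳ α ⟨
    α * 1ℚ       ≤⟨ ℚP.*-monoˡ-≤-nonNeg α (1≤pow (ℚP.<⇒≤ α>1) j) ⟩
    α * pow α j  ∎)

∣pow∣≡pow∣∣ : ∀ q n → ℚ.∣ pow q n ∣ ≡ pow ℚ.∣ q ∣ n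
∣pow∣≡pow∣∣ q zero    = refl
∣pow∣≡pow∣∣ q (suc n) = trans (ℚP.∣p*q∣≡∣p∣*∣q∣ q (pow q n)) (cong (ℚ.∣ q ∣ *_) (∣pow∣≡pow∣∣ q n))

pow-suc≢1 : ∀ {q} → q ≢ 1ℚ → q ≢ - 1ℚ → ∀ j → pow q (suc j) ≢ 1ℚ
pow-suc≢1 {q} q≢1 q≢-1 j qʲ⁺¹≡1 =
  pow-suc≢1-nonNeg ℚ.∣ q ∣ {{ℚP.∣-∣-nonNeg q}} ∣q∣≢1 j
    (trans (sym (∣pow∣≡pow∣∣ q (suc j))) (cong ℚ.∣_∣ qʲ⁺¹≡1))
  where
  ∣q∣≢1 : ℚ.∣ q ∣ ≢ 1ℚ
  ∣q∣≢1 ∣q∣≡1 with ℚP.∣p∣≡p∨∣p∣≡-p q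
  ... | inj₁ ∣q∣≡q  = q≢1 (trans (sym ∣q∣≡q) ∣q∣≡1)
  ... | inj₂ ∣q∣≡-q =
    q≢-1 (trans (sym (GroupProperties.⁻¹-involutive ℚP.+-0-group q)) (cong -_ (trans (sym ∣q∣≡-q) ∣q∣≡1)))

open ≡-Reasoning

-- i / 1 and 1 / d are propositionally the normal forms mkℚ i 0 and mkℚ 1 (d-1), on which _+_ and
-- _*_ unfold definitionally.
private
  mkℚ/1 : ℤ → ℚ
  mkℚ/1 i = ℚ.mkℚ i 0 (Coprimality.sym (Coprimality.1-coprimeTo _))

  /1≡mkℚ/1 : ∀ i → i / 1 ≡ mkℚ/1 i
  /1≡mkℚ/1 i = ℚP.↥p/↧p≡p (mkℚ/1 i)

  mkℚ1/ : ℕ → ℚ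
  mkℚ1/ d = ℚ.mkℚ (+ 1) d (Coprimality.1-coprimeTo (suc d))

/1-homo-+ : ∀ i j → (i ℤ.+ j) / 1 ≡ i / 1 + j / 1
/1-homo-+ i j = begin
  (i ℤ.+ j) / 1                          ≡⟨ ℚP./-cong (cong₂ ℤ._+_ (sym (ℤP.*-identityʳ i)) (sym (ℤP.*-identityʳ j))) refl ⟩
  (i ℤ.* + 1 ℤ.+ j ℤ.* + 1) / (1 *ℕ 1)  ≡⟨ cong₂ _+_ (/1≡mkℚ/1 i) (/1≡mkℚ/1 j) ⟨
  i / 1 + j / 1                          ∎

/1-homo-* : ∀ i j → (i ℤ.* j) / 1 ≡ (i / 1) * (j / 1)
/1-homo-* i j = sym (cong₂ _*_ (/1≡mkℚ/1 i) (/1≡mkℚ/1 j))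

/1-homo-- : ∀ i j → (i -ℤ j) / 1 ≡ i / 1 - j / 1
/1-homo-- i j = begin
  (i -ℤ j) / 1                   ≡⟨ x≡x+y-y ((i -ℤ j) / 1) (j / 1) ⟩
  (i -ℤ j) / 1 + j / 1 - j / 1   ≡⟨ cong (_- j / 1) (/1-homo-+ (i -ℤ j) j) ⟨
  (i -ℤ j ℤ.+ j) / 1 - j / 1     ≡⟨ cong (λ k → k / 1 - j / 1) (i-j+j≡i i j) ⟩
  i / 1 - j / 1                  ∎
  where
  x≡x+y-y : ∀ x y → x ≡ x + y - y
  x≡x+y-y = solve-∀ ℚ-ring
  i-j+j≡i : ∀ i j → i -ℤ j ℤ.+ j ≡ i
  i-j+j≡i = ℤ-Solver.solve-∀

i/n≡[i/1]*[1/n] : ∀ i d → i / suc d ≡ (i / 1) * (+ 1 / suc d)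
i/n≡[i/1]*[1/n] i d = begin
  i / suc d                   ≡⟨ ℚP./-cong (sym (ℤP.*-identityʳ i)) (sym (ℕP.*-identityˡ (suc d))) ⟩
  (i ℤ.* + 1) / (1 *ℕ suc d)  ≡⟨ cong₂ _*_ (/1≡mkℚ/1 i) (ℚP.↥p/↧p≡p (mkℚ1/ d)) ⟨
  (i / 1) * (+ 1 / suc d)     ∎

+[1+n]/1≡+n/1+1 : ∀ n → + suc n / 1 ≡ + n / 1 + 1ℚ
+[1+n]/1≡+n/1+1 n = trans (cong (λ k → + k / 1) (ℕP.+-comm 1 n)) (/1-homo-+ (+ n) (+ 1))

-- The sum a(K) + a(K′)

tri-as-polynomial : ∀ ε x → tri ε x ≡ + x / 1 * (+ x / 1 - ε / 1) * (+ 1 / 2)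
tri-as-polynomial ε x = begin
  ((+ x) *ℤ ((+ x) -ℤ ε)) / 2                   ≡⟨ i/n≡[i/1]*[1/n] ((+ x) *ℤ ((+ x) -ℤ ε)) 1 ⟩
  ((+ x) *ℤ ((+ x) -ℤ ε)) / 1 * (+ 1 / 2)       ≡⟨ cong (_* (+ 1 / 2)) (/1-homo-* (+ x) ((+ x) -ℤ ε)) ⟩
  + x / 1 * (((+ x) -ℤ ε) / 1) * (+ 1 / 2)      ≡⟨ cong (λ y → + x / 1 * y * (+ 1 / 2)) (/1-homo-- (+ x) ε) ⟩
  + x / 1 * (+ x / 1 - ε / 1) * (+ 1 / 2)       ∎

sum-elems-∁ : ∀ (f : ℕ → ℚ) o {n} (K : Subset n) →
  sumℚ (map f (elems o K)) + sumℚ (map f (elems o (∁ K))) ≡ sumℚ (map f (elems o (⊤ {n})))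
sum-elems-∁ f o []          = refl
sum-elems-∁ f o (true ∷ K)  =
  trans (ℚP.+-assoc (f (suc o)) _ _) (cong (_+_ (f (suc o))) (sum-elems-∁ f (suc o) K))
sum-elems-∁ f o (false ∷ K) =
  trans (+-Properties.x∙yz≈y∙xz (sumℚ (map f (elems (suc o) K))) (f (suc o)) (sumℚ (map f (elems (suc o) (∁ K)))))
        (cong (_+_ (f (suc o))) (sum-elems-∁ f (suc o) K))
  where
  module +-Properties = CommSemigroupProperties (CommutativeMonoid.commutativeSemigroup ℚP.+-0-commutativeMonoid)

sum-elems-⊤-telescopic : ∀ (f F : ℕ → ℚ) → (∀ i → f (suc i) ≡ F (suc i) - F i) →
  ∀ o n → sumℚ (map f (elems o (⊤ {n}))) ≡ F (o ℕ.+ n) - F o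
sum-elems-⊤-telescopic f F f≡ΔF o zero    = begin
  0ℚ            ≡⟨ ℚP.+-inverseʳ (F o) ⟨
  F o - F o     ≡⟨ cong (λ k → F k - F o) (ℕP.+-identityʳ o) ⟨
  F (o ℕ.+ 0) - F o ∎
sum-elems-⊤-telescopic f F f≡ΔF o (suc n) = begin
  f (suc o) + sumℚ (map f (elems (suc o) (⊤ {n})))
    ≡⟨ cong₂ _+_ (f≡ΔF o) (sum-elems-⊤-telescopic f F f≡ΔF (suc o) n) ⟩
  (F (suc o) - F o) + (F (suc o ℕ.+ n) - F (suc o))
    ≡⟨ telescope (F (suc o)) (F o) (F (suc o ℕ.+ n)) ⟩
  F (suc o ℕ.+ n) - F o
    ≡⟨ cong (λ k → F k - F o) (ℕP.+-suc o n) ⟨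
  F (o ℕ.+ suc n) - F o ∎
  where
  telescope : ∀ x y z → (x - y) + (z - x) ≡ z - y
  telescope = solve-∀ ℚ-ring

-- triSum e n = Σ_{i=1}^{n} i(i-e)/2
triSum : ℚ → ℚ → ℚ
triSum e x = x * (x + 1ℚ) * (x + x + 1ℚ - (+ 3 / 1) * e) * (+ 1 / 12)

triSum-step : ∀ e x → triSum e (x + 1ℚ) - triSum e x ≡ (x + 1ℚ) * ((x + 1ℚ) - e) * (+ 1 / 2)
triSum-step = lemma
  where
  lemma : ∀ e x → (x + 1ℚ) * ((x + 1ℚ) + 1ℚ) * ((x + 1ℚ) + (x + 1ℚ) + 1ℚ - (+ 3 / 1) * e) * (+ 1 / 12)
                    - x * (x + 1ℚ) * (x + x + 1ℚ - (+ 3 / 1) * e) * (+ 1 / 12)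
                  ≡ (x + 1ℚ) * ((x + 1ℚ) - e) * (+ 1 / 2)
  lemma = solve-∀ ℚ-ring

a-partialSum : ℤ → ℚ → ℕ → ℚ
a-partialSum ε T n = + n / 1 * T - triSum (ε / 1) (+ n / 1)

a-partialSum-step : ∀ ε T i → T - tri ε (suc i) ≡ a-partialSum ε T (suc i) - a-partialSum ε T i
a-partialSum-step ε T i = begin
  T - tri ε (suc i)
    ≡⟨ cong (_-_ T) (tri-as-polynomial ε (suc i)) ⟩
  T - + suc i / 1 * (+ suc i / 1 - E) * (+ 1 / 2)
    ≡⟨ cong (λ y → T - y * (y - E) * (+ 1 / 2)) (+[1+n]/1≡+n/1+1 i) ⟩
  T - (x + 1ℚ) * ((x + 1ℚ) - E) * (+ 1 / 2)
    ≡⟨ cong (_-_ T) (triSum-step E x) ⟨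
  T - (triSum E (x + 1ℚ) - triSum E x)
    ≡⟨ rearrange x T (triSum E x) (triSum E (x + 1ℚ)) ⟩
  ((x + 1ℚ) * T - triSum E (x + 1ℚ)) - (x * T - triSum E x)
    ≡⟨ cong (λ y → (y * T - triSum E y) - a-partialSum ε T i) (+[1+n]/1≡+n/1+1 i) ⟨
  a-partialSum ε T (suc i) - a-partialSum ε T i ∎
  where
  x = + i / 1
  E = ε / 1
  rearrange : ∀ x T s s′ → T - (s′ - s) ≡ ((x + 1ℚ) * T - s′) - (x * T - s)
  rearrange = solve-∀ ℚ-ring

a+a∁ : ∀ m ε (K : Subset m) →
  a (suc m) ε K + a (suc m) ε (∁ K)
    ≡ (1ℚ ⊘ (+ 3 / 1)) * ((+ suc m / 1) * (+ m / 1) * ((+ suc m / 1) + ((+ 1 -ℤ (+ 3 *ℤ ε)) / 4)))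
a+a∁ m ε K = begin
  a (suc m) ε K + a (suc m) ε (∁ K)
    ≡⟨ sum-elems-∁ (λ i → T - tri ε i) 0 K ⟩
  sumℚ (map (λ i → T - tri ε i) (elems 0 (⊤ {m})))
    ≡⟨ sum-elems-⊤-telescopic (λ i → T - tri ε i) (a-partialSum ε T) (a-partialSum-step ε T) 0 m ⟩
  x * T - triSum E x - (0ℚ * T - triSum E 0ℚ)
    ≡⟨ cong (λ T → x * T - triSum E x - (0ℚ * T - triSum E 0ℚ)) T≡ ⟩
  x * T′ - triSum E x - (0ℚ * T′ - triSum E 0ℚ)
    ≡⟨ closed-form x E ⟩
  (1ℚ ⊘ (+ 3 / 1)) * ((x + 1ℚ) * x * ((x + 1ℚ) + (1ℚ - (+ 3 / 1) * E) * (+ 1 / 4)))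
    ≡⟨ cong₂ (λ y z → (1ℚ ⊘ (+ 3 / 1)) * (y * x * (y + z))) (+[1+n]/1≡+n/1+1 m) [1-3ε]/4≡ ⟨
  (1ℚ ⊘ (+ 3 / 1)) * ((+ suc m / 1) * x * ((+ suc m / 1) + ((+ 1 -ℤ (+ 3 *ℤ ε)) / 4))) ∎
  where
  x = + m / 1
  E = ε / 1
  T = tri ε (suc m)
  T′ = (x + 1ℚ) * ((x + 1ℚ) - E) * (+ 1 / 2)
  T≡ : T ≡ T′
  T≡ = trans (tri-as-polynomial ε (suc m)) (cong (λ y → y * (y - E) * (+ 1 / 2)) (+[1+n]/1≡+n/1+1 m))
  [1-3ε]/4≡ : (+ 1 -ℤ (+ 3 *ℤ ε)) / 4 ≡ (1ℚ - (+ 3 / 1) * E) * (+ 1 / 4)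
  [1-3ε]/4≡ = begin
    (+ 1 -ℤ (+ 3 *ℤ ε)) / 4                ≡⟨ i/n≡[i/1]*[1/n] (+ 1 -ℤ (+ 3 *ℤ ε)) 3 ⟩
    ((+ 1 -ℤ (+ 3 *ℤ ε)) / 1) * (+ 1 / 4)  ≡⟨ cong (_* (+ 1 / 4)) (/1-homo-- (+ 1) (+ 3 *ℤ ε)) ⟩
    (1ℚ - (+ 3 *ℤ ε) / 1) * (+ 1 / 4)      ≡⟨ cong (λ y → (1ℚ - y) * (+ 1 / 4)) (/1-homo-* (+ 3) ε) ⟩
    (1ℚ - (+ 3 / 1) * E) * (+ 1 / 4)       ∎
  closed-form : ∀ x E →
    x * ((x + 1ℚ) * ((x + 1ℚ) - E) * (+ 1 / 2))
      - x * (x + 1ℚ) * (x + x + 1ℚ - (+ 3 / 1) * E) * (+ 1 / 12)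
      - (0ℚ * ((x + 1ℚ) * ((x + 1ℚ) - E) * (+ 1 / 2))
         - 0ℚ * (0ℚ + 1ℚ) * (0ℚ + 0ℚ + 1ℚ - (+ 3 / 1) * E) * (+ 1 / 12))
    ≡ (1ℚ ⊘ (+ 3 / 1)) * ((x + 1ℚ) * x * ((x + 1ℚ) + (1ℚ - (+ 3 / 1) * E) * (+ 1 / 4)))
  closed-form = solve-∀ ℚ-ring

-- Total, with 0 ⁻¹ = 0; this is why ⁻¹-distrib-* needs no side conditions.
infix 8 _⁻¹

_⁻¹ : ℚ → ℚ
x ⁻¹ = 1ℚ ⊘ x

⊘≡*⁻¹ : ∀ x y → x ⊘ y ≡ x * y ⁻¹
⊘≡*⁻¹ x y with y ℚP.≟ 0ℚ
... | yes _ = sym (ℚP.*-zeroʳ x)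
... | no _  = cong (x *_) (sym (ℚP.*-identityˡ _))

⁻¹-inverseʳ : ∀ {x} → x ≢ 0ℚ → x * x ⁻¹ ≡ 1ℚ
⁻¹-inverseʳ {x} x≢0 with x ℚP.≟ 0ℚ
... | yes x≡0 = contradiction x≡0 x≢0
... | no x≢0  = trans (cong (x *_) (ℚP.*-identityˡ _)) (ℚP.*-inverseʳ x {{ℚ.≢-nonZero x≢0}})

⁻¹-inverseˡ : ∀ {x} → x ≢ 0ℚ → x ⁻¹ * x ≡ 1ℚ
⁻¹-inverseˡ {x} x≢0 = trans (ℚP.*-comm (x ⁻¹) x) (⁻¹-inverseʳ x≢0)

⁻¹-cancelˡ : ∀ {x} → x ≢ 0ℚ → ∀ y → x ⁻¹ * (x * y) ≡ y
⁻¹-cancelˡ {x} x≢0 y = begin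
  x ⁻¹ * (x * y)  ≡⟨ ℚP.*-assoc (x ⁻¹) x y ⟨
  x ⁻¹ * x * y    ≡⟨ cong (_* y) (⁻¹-inverseˡ x≢0) ⟩
  1ℚ * y          ≡⟨ ℚP.*-identityˡ y ⟩
  y               ∎

⁻¹-unique : ∀ {x y} → x * y ≡ 1ℚ → x ⁻¹ ≡ y
⁻¹-unique {x} {y} xy≡1 = begin
  x ⁻¹            ≡⟨ ℚP.*-identityʳ (x ⁻¹) ⟨
  x ⁻¹ * 1ℚ       ≡⟨ cong (x ⁻¹ *_) xy≡1 ⟨
  x ⁻¹ * (x * y)  ≡⟨ ⁻¹-cancelˡ x≢0 y ⟩
  y               ∎
  where
  x≢0 : x ≢ 0ℚ
  x≢0 refl = ℚP.1≢0 (trans (sym xy≡1) (ℚP.*-zeroˡ y))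

*-≢0 : ∀ {x y} → x ≢ 0ℚ → y ≢ 0ℚ → x * y ≢ 0ℚ
*-≢0 {x} {y} x≢0 y≢0 xy≡0 = y≢0 (begin
  y               ≡⟨ ⁻¹-cancelˡ x≢0 y ⟨
  x ⁻¹ * (x * y)  ≡⟨ cong (x ⁻¹ *_) xy≡0 ⟩
  x ⁻¹ * 0ℚ       ≡⟨ ℚP.*-zeroʳ (x ⁻¹) ⟩
  0ℚ              ∎)

⁻¹-distrib-* : ∀ x y → (x * y) ⁻¹ ≡ x ⁻¹ * y ⁻¹
⁻¹-distrib-* x y = by-cases (x ℚP.≟ 0ℚ) (y ℚP.≟ 0ℚ)
  where
  interchange : ∀ a b c d → a * b * (c * d) ≡ a * c * (b * d)
  interchange = solve-∀ ℚ-ring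
  by-cases : Dec (x ≡ 0ℚ) → Dec (y ≡ 0ℚ) → (x * y) ⁻¹ ≡ x ⁻¹ * y ⁻¹
  by-cases (yes refl) _        = trans (cong _⁻¹ (ℚP.*-zeroˡ y)) (sym (ℚP.*-zeroˡ (y ⁻¹)))
  by-cases (no _)     (yes refl) = trans (cong _⁻¹ (ℚP.*-zeroʳ x)) (sym (ℚP.*-zeroʳ (x ⁻¹)))
  by-cases (no x≢0)   (no y≢0) = ⁻¹-unique {x * y} (begin
    x * y * (x ⁻¹ * y ⁻¹)  ≡⟨ interchange x y (x ⁻¹) (y ⁻¹) ⟩
    x * x ⁻¹ * (y * y ⁻¹)  ≡⟨ cong₂ _*_ (⁻¹-inverseʳ x≢0) (⁻¹-inverseʳ y≢0) ⟩
    1ℚ                     ∎)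

⁻¹-distrib-prodℚ : ∀ {A : Set} (f : A → ℚ) xs → (prodℚ (map f xs)) ⁻¹ ≡ prodℚ (map (λ d → f d ⁻¹) xs)
⁻¹-distrib-prodℚ f []       = refl
⁻¹-distrib-prodℚ f (d ∷ xs) = trans (⁻¹-distrib-* (f d) _) (cong (f d ⁻¹ *_) (⁻¹-distrib-prodℚ f xs))


sumℚ-map-++ : ∀ {A : Set} (f : A → ℚ) xs ys →
  sumℚ (map f (xs ++ ys)) ≡ sumℚ (map f xs) + sumℚ (map f ys)
sumℚ-map-++ f []       ys = sym (ℚP.+-identityˡ _)
sumℚ-map-++ f (x ∷ xs) ys =
  trans (cong (_+_ (f x)) (sumℚ-map-++ f xs ys)) (sym (ℚP.+-assoc (f x) _ _))

*-distribˡ-sumℚ-map : ∀ {A : Set} k (f : A → ℚ) xs → k * sumℚ (map f xs) ≡ sumℚ (map (λ x → k * f x) xs)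
*-distribˡ-sumℚ-map k f []       = ℚP.*-zeroʳ k
*-distribˡ-sumℚ-map k f (x ∷ xs) =
  trans (ℚP.*-distribˡ-+ k (f x) _) (cong (_+_ (k * f x)) (*-distribˡ-sumℚ-map k f xs))

neg-distrib-sumℚ-map : ∀ {A : Set} (f : A → ℚ) xs → - sumℚ (map f xs) ≡ sumℚ (map (λ x → - f x) xs)
neg-distrib-sumℚ-map f []       = refl
neg-distrib-sumℚ-map f (x ∷ xs) =
  trans (ℚP.neg-distrib-+ (f x) _) (cong (_+_ (- f x)) (neg-distrib-sumℚ-map f xs))

-- Signed gap sums

signedGapSum : (ℕ → ℚ) → ℕ → {n : ℕ} → Subset n → ℚ
signedGapSum s c K = sumℚ (map (λ I → sgn ∣ K ─ I ∣ * prodℚ (map s (gaps c I))) (subsetsOf K))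

-- signedGapSum s c computed position by position: a position outside K extends the current gap
-- (of length c + 1 so far); one in K either belongs to I, closing the gap, or does not, extending
-- it and flipping the sign.
Ψ : (ℕ → ℚ) → ℕ → List Bool → ℚ
Ψ s c []          = s (suc c)
Ψ s c (false ∷ b) = Ψ s (suc c) b
Ψ s c (true ∷ b)  = s (suc c) * Ψ s 0 b - Ψ s (suc c) b

signedGapSum≡Ψ : ∀ s c {n} (K : Subset n) → signedGapSum s c K ≡ Ψ s c (toList K)
signedGapSum≡Ψ s c []          = trans (ℚP.+-identityʳ _) (trans (ℚP.*-identityˡ _) (ℚP.*-identityʳ _))
signedGapSum≡Ψ s c (false ∷ K) =
  trans (cong sumℚ (sym (map-∘ (subsetsOf K)))) (signedGapSum≡Ψ s (suc c) K)
signedGapSum≡Ψ s c (true ∷ K)  = begin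
  sumℚ (map term (map (true ∷_) (subsetsOf K) ++ map (false ∷_) (subsetsOf K)))
    ≡⟨ sumℚ-map-++ term (map (true ∷_) (subsetsOf K)) (map (false ∷_) (subsetsOf K)) ⟩
  sumℚ (map term (map (true ∷_) (subsetsOf K))) + sumℚ (map term (map (false ∷_) (subsetsOf K)))
    ≡⟨ cong₂ _+_ (cong sumℚ (sym (map-∘ (subsetsOf K)))) (cong sumℚ (sym (map-∘ (subsetsOf K)))) ⟩
  sumℚ (map (λ I → sgn ∣ K ─ I ∣ * (σ * prodℚ (map s (gaps 0 I)))) (subsetsOf K))
    + sumℚ (map (λ I → - sgn ∣ K ─ I ∣ * prodℚ (map s (gaps (suc c) I))) (subsetsOf K))
    ≡⟨ cong₂ _+_ (cong sumℚ (map-cong (λ I → x[yz]≡y[xz] (sgn ∣ K ─ I ∣) σ _) (subsetsOf K)))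
                 (cong sumℚ (map-cong (λ I → sym (ℚP.neg-distribˡ-* (sgn ∣ K ─ I ∣) _)) (subsetsOf K))) ⟩
  sumℚ (map (λ I → σ * (sgn ∣ K ─ I ∣ * prodℚ (map s (gaps 0 I)))) (subsetsOf K))
    + sumℚ (map (λ I → - (sgn ∣ K ─ I ∣ * prodℚ (map s (gaps (suc c) I)))) (subsetsOf K))
    ≡⟨ cong₂ _+_ (*-distribˡ-sumℚ-map σ _ (subsetsOf K)) (neg-distrib-sumℚ-map _ (subsetsOf K)) ⟨
  σ * signedGapSum s 0 K - signedGapSum s (suc c) K
    ≡⟨ cong₂ (λ u v → σ * u - v) (signedGapSum≡Ψ s 0 K) (signedGapSum≡Ψ s (suc c) K) ⟩
  σ * Ψ s 0 (toList K) - Ψ s (suc c) (toList K) ∎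
  where
  σ = s (suc c)
  term : Subset _ → ℚ
  term I = sgn ∣ (true ∷ K) ─ I ∣ * prodℚ (map s (gaps c I))
  x[yz]≡y[xz] : ∀ x y z → x * (y * z) ≡ y * (x * z)
  x[yz]≡y[xz] = solve-∀ ℚ-ring

φ⁻¹ : ℚ → ℕ → ℚ
φ⁻¹ q n = φ n q ⁻¹

w≡φ*Ψ : ∀ ℓ K q → w ℓ K q ≡ φ ℓ q * Ψ (φ⁻¹ q) 0 (toList K)
w≡φ*Ψ ℓ K q = begin
  w ℓ K q
    ≡⟨ cong sumℚ (map-cong (λ I → cong (sgn ∣ K ─ I ∣ *_) (φ₍₎≡ I)) (subsetsOf K)) ⟩
  sumℚ (map (λ I → sgn ∣ K ─ I ∣ * (φ ℓ q * prodℚ (map (λ d → φ d q ⁻¹) (gaps 0 I)))) (subsetsOf K))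
    ≡⟨ cong sumℚ (map-cong (λ I → x[yz]≡y[xz] (sgn ∣ K ─ I ∣) (φ ℓ q) _) (subsetsOf K)) ⟩
  sumℚ (map (λ I → φ ℓ q * (sgn ∣ K ─ I ∣ * prodℚ (map (λ d → φ d q ⁻¹) (gaps 0 I)))) (subsetsOf K))
    ≡⟨ *-distribˡ-sumℚ-map (φ ℓ q) _ (subsetsOf K) ⟨
  φ ℓ q * signedGapSum (φ⁻¹ q) 0 K
    ≡⟨ cong (φ ℓ q *_) (signedGapSum≡Ψ _ 0 K) ⟩
  φ ℓ q * Ψ (φ⁻¹ q) 0 (toList K) ∎
  where
  x[yz]≡y[xz] : ∀ x y z → x * (y * z) ≡ y * (x * z)
  x[yz]≡y[xz] = solve-∀ ℚ-ring
  φ₍₎≡ : ∀ I → φ₍₎ ℓ I q ≡ φ ℓ q * prodℚ (map (λ d → φ d q ⁻¹) (gaps 0 I))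
  φ₍₎≡ I = trans (⊘≡*⁻¹ (φ ℓ q) (prodℚ (map (λ d → φ d q) (gaps 0 I)))) (cong (φ ℓ q *_) (⁻¹-distrib-prodℚ (λ d → φ d q) (gaps 0 I)))

Ψ-cong : ∀ {s t} → (∀ n → s n ≡ t n) → ∀ c b → Ψ s c b ≡ Ψ t c b
Ψ-cong s≗t c []          = s≗t (suc c)
Ψ-cong s≗t c (false ∷ b) = Ψ-cong s≗t (suc c) b
Ψ-cong s≗t c (true ∷ b)  =
  cong₂ _-_ (cong₂ _*_ (s≗t (suc c)) (Ψ-cong s≗t 0 b)) (Ψ-cong s≗t (suc c) b)

Ψ-split : ∀ s c B d → Ψ s c (B ++ true ∷ d) + Ψ s c (B ++ false ∷ d) ≡ Ψ s c B * Ψ s 0 d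
Ψ-split s c []          d = x*y-z+z≡x*y (s (suc c)) (Ψ s 0 d) (Ψ s (suc c) d)
  where
  x*y-z+z≡x*y : ∀ x y z → (x * y - z) + z ≡ x * y
  x*y-z+z≡x*y = solve-∀ ℚ-ring
Ψ-split s c (false ∷ B) d = Ψ-split s (suc c) B d
Ψ-split s c (true ∷ B)  d = begin
  (σ * Ψ s 0 (B ++ true ∷ d) - Ψ s (suc c) (B ++ true ∷ d))
    + (σ * Ψ s 0 (B ++ false ∷ d) - Ψ s (suc c) (B ++ false ∷ d))
    ≡⟨ regroup σ _ _ _ _ ⟩
  σ * (Ψ s 0 (B ++ true ∷ d) + Ψ s 0 (B ++ false ∷ d))
    - (Ψ s (suc c) (B ++ true ∷ d) + Ψ s (suc c) (B ++ false ∷ d))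
    ≡⟨ cong₂ (λ u v → σ * u - v) (Ψ-split s 0 B d) (Ψ-split s (suc c) B d) ⟩
  σ * (Ψ s 0 B * Ψ s 0 d) - Ψ s (suc c) B * Ψ s 0 d
    ≡⟨ factor σ _ _ _ ⟩
  (σ * Ψ s 0 B - Ψ s (suc c) B) * Ψ s 0 d ∎
  where
  σ = s (suc c)
  regroup : ∀ a x y u v → (a * x - u) + (a * y - v) ≡ a * (x + y) - (u + v)
  regroup = solve-∀ ℚ-ring
  factor : ∀ a x y z → a * (x * z) - y * z ≡ (a * x - y) * z
  factor = solve-∀ ℚ-ring

Ψ-scale : ∀ a s c b → Ψ (λ n → pow a n * s n) c b ≡ pow a (suc c ℕ.+ length b) * Ψ s c b
Ψ-scale a s c []          = cong (λ n → pow a n * s (suc c)) (sym (ℕP.+-identityʳ (suc c)))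
Ψ-scale a s c (false ∷ b) =
  trans (Ψ-scale a s (suc c) b) (cong (λ n → pow a n * Ψ s (suc c) b) (sym (ℕP.+-suc (suc c) (length b))))
Ψ-scale a s c (true ∷ b)  = begin
  pow a (suc c) * s (suc c) * Ψ (λ n → pow a n * s n) 0 b - Ψ (λ n → pow a n * s n) (suc c) b
    ≡⟨ cong₂ (λ u v → pow a (suc c) * s (suc c) * u - v) (Ψ-scale a s 0 b) (Ψ-scale a s (suc c) b) ⟩
  pow a (suc c) * s (suc c) * (pow a (suc (length b)) * Ψ s 0 b) - pow a (suc (suc c) ℕ.+ length b) * Ψ s (suc c) b
    ≡⟨ regroup (pow a (suc c)) (s (suc c)) (pow a (suc (length b))) (Ψ s 0 b) (pow a (suc (suc c) ℕ.+ length b)) (Ψ s (suc c) b) ⟩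
  pow a (suc c) * pow a (suc (length b)) * (s (suc c) * Ψ s 0 b) - pow a (suc (suc c) ℕ.+ length b) * Ψ s (suc c) b
    ≡⟨ cong₂ (λ u v → u * (s (suc c) * Ψ s 0 b) - v * Ψ s (suc c) b)
             (sym (pow-+ a (suc c) (suc (length b)))) (cong (pow a) (sym (ℕP.+-suc (suc c) (length b)))) ⟩
  pow a (suc c ℕ.+ suc (length b)) * (s (suc c) * Ψ s 0 b) - pow a (suc c ℕ.+ suc (length b)) * Ψ s (suc c) b
    ≡⟨ factor (pow a (suc c ℕ.+ suc (length b))) _ _ ⟩
  pow a (suc c ℕ.+ suc (length b)) * (s (suc c) * Ψ s 0 b - Ψ s (suc c) b) ∎
  where
  factor : ∀ p x y → p * x - p * y ≡ p * (x - y)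
  factor = solve-∀ ℚ-ring
  regroup : ∀ p x q y r z → p * x * (q * y) - r * z ≡ p * q * (x * y) - r * z
  regroup = solve-∀ ℚ-ring

replicate-++-∷ : ∀ {A : Set} n (x : A) ys → replicate n x ++ x ∷ ys ≡ x ∷ (replicate n x ++ ys)
replicate-++-∷ zero    x ys = refl
replicate-++-∷ (suc n) x ys = cong (x ∷_) (replicate-++-∷ n x ys)

Ψ-dual : ∀ s t → (∀ k → Ψ s 0 (replicate k true) ≡ t (suc k)) →
  ∀ c b → Ψ t c b ≡ Ψ s 0 (replicate c true ++ map not b)
Ψ-dual s t Ψs≡t c []          =
  sym (trans (cong (Ψ s 0) (++-identityʳ (replicate c true))) (Ψs≡t c))
Ψ-dual s t Ψs≡t c (false ∷ b) =
  trans (Ψ-dual s t Ψs≡t (suc c) b) (cong (Ψ s 0) (sym (replicate-++-∷ c true (map not b))))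
Ψ-dual s t Ψs≡t c (true ∷ b)  = begin
  t (suc c) * Ψ t 0 b - Ψ t (suc c) b
    ≡⟨ cong₂ (λ u v → t (suc c) * u - v) (Ψ-dual s t Ψs≡t 0 b) (Ψ-dual s t Ψs≡t (suc c) b) ⟩
  t (suc c) * Ψ s 0 b′ - Ψ s 0 (true ∷ (replicate c true ++ b′))
    ≡⟨ cong₂ (λ u v → u * Ψ s 0 b′ - Ψ s 0 v) (sym (Ψs≡t c)) (sym (replicate-++-∷ c true b′)) ⟩
  Ψ s 0 (replicate c true) * Ψ s 0 b′ - Ψ s 0 (replicate c true ++ true ∷ b′)
    ≡⟨ cong (_- Ψ s 0 (replicate c true ++ true ∷ b′)) (Ψ-split s 0 (replicate c true) b′) ⟨
  Ψ s 0 (replicate c true ++ true ∷ b′) + Ψ s 0 (replicate c true ++ false ∷ b′)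
    - Ψ s 0 (replicate c true ++ true ∷ b′)
    ≡⟨ x+y-x≡y (Ψ s 0 (replicate c true ++ true ∷ b′)) _ ⟩
  Ψ s 0 (replicate c true ++ false ∷ b′) ∎
  where
  b′ = map not b
  x+y-x≡y : ∀ x y → x + y - x ≡ y
  x+y-x≡y = solve-∀ ℚ-ring

-- The q-identities

pow-suc-1≢0 : ∀ {q} → q ≢ 1ℚ → q ≢ - 1ℚ → ∀ j → pow q (suc j) - 1ℚ ≢ 0ℚ
pow-suc-1≢0 q≢1 q≢-1 j = pow-suc≢1 q≢1 q≢-1 j ∘ +-GroupProperties.x∙y⁻¹≈ε⇒x≈y _ _
  where module +-GroupProperties = GroupProperties ℚP.+-0-group

φ≢0 : ∀ {q} → q ≢ 1ℚ → q ≢ - 1ℚ → ∀ n → φ n q ≢ 0ℚ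
φ≢0 q≢1 q≢-1 zero    = ℚP.1≢0
φ≢0 q≢1 q≢-1 (suc n) = *-≢0 (pow-suc-1≢0 q≢1 q≢-1 n) (φ≢0 q≢1 q≢-1 n)

triangular : ℕ → ℕ
triangular zero    = 0
triangular (suc n) = n ℕ.+ triangular n

triangular-*2 : ∀ n → triangular (suc n) *ℕ 2 ≡ suc n *ℕ n
triangular-*2 zero    = refl
triangular-*2 (suc n) = begin
  (suc n ℕ.+ triangular (suc n)) *ℕ 2     ≡⟨ ℕP.*-distribʳ-+ 2 (suc n) (triangular (suc n)) ⟩
  suc n *ℕ 2 ℕ.+ triangular (suc n) *ℕ 2  ≡⟨ cong (suc n *ℕ 2 ℕ.+_) (triangular-*2 n) ⟩
  suc n *ℕ 2 ℕ.+ suc n *ℕ n               ≡⟨ ℕP.*-distribˡ-+ (suc n) 2 n ⟨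
  suc n *ℕ suc (suc n)                    ≡⟨ ℕP.*-comm (suc n) (suc (suc n)) ⟩
  suc (suc n) *ℕ suc n                    ∎

[[1+m]*m]/2≡triangular : ∀ m → (suc m *ℕ m) div 2 ≡ triangular (suc m)
[[1+m]*m]/2≡triangular m = trans (cong (_div 2) (sym (triangular-*2 m))) (m*n/n≡m (triangular (suc m)) 2)

partial-fractions : ∀ r p → r - 1ℚ ≢ 0ℚ → p - 1ℚ ≢ 0ℚ → r * p - 1ℚ ≢ 0ℚ →
  (r - 1ℚ) ⁻¹ * (p - 1ℚ) ⁻¹ - (r * p - 1ℚ) ⁻¹ * (r - 1ℚ) ⁻¹ ≡ p * (r * p - 1ℚ) ⁻¹ * (p - 1ℚ) ⁻¹
partial-fractions r p r-1≢0 p-1≢0 rp-1≢0 = begin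
  A * B - C * A
    ≡⟨ times-one A B C ⟩
  A * B * 1ℚ - C * A * 1ℚ
    ≡⟨ cong₂ (λ x y → A * B * x - C * A * y) (⁻¹-inverseˡ rp-1≢0) (⁻¹-inverseˡ p-1≢0) ⟨
  A * B * (C * (r * p - 1ℚ)) - C * A * (B * (p - 1ℚ))
    ≡⟨ expand A B C r p ⟩
  p * C * B * (A * (r - 1ℚ))
    ≡⟨ cong (p * C * B *_) (⁻¹-inverseˡ r-1≢0) ⟩
  p * C * B * 1ℚ
    ≡⟨ ℚP.*-identityʳ (p * C * B) ⟩
  p * C * B ∎
  where
  A = (r - 1ℚ) ⁻¹
  B = (p - 1ℚ) ⁻¹
  C = (r * p - 1ℚ) ⁻¹
  times-one : ∀ A B C → A * B - C * A ≡ A * B * 1ℚ - C * A * 1ℚ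
  times-one = solve-∀ ℚ-ring
  expand : ∀ A B C r p → A * B * (C * (r * p - 1ℚ)) - C * A * (B * (p - 1ℚ)) ≡ p * C * B * (A * (r - 1ℚ))
  expand = solve-∀ ℚ-ring

module _ {q : ℚ} (q≢1 : q ≢ 1ℚ) (q≢-1 : q ≢ - 1ℚ) where

  -- The closed form with an arbitrary initial gap c is what makes the induction on k go through.
  Ψ-φ⁻¹-replicate : ∀ k c → Ψ (φ⁻¹ q) c (replicate k true)
    ≡ pow q (triangular (suc k)) * (pow q (suc c ℕ.+ k) - 1ℚ) ⁻¹ * φ c q ⁻¹ * φ k q ⁻¹
  Ψ-φ⁻¹-replicate zero    c = begin
    ((pow q (suc c) - 1ℚ) * φ c q) ⁻¹
      ≡⟨ ⁻¹-distrib-* (pow q (suc c) - 1ℚ) (φ c q) ⟩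
    (pow q (suc c) - 1ℚ) ⁻¹ * φ c q ⁻¹
      ≡⟨ pad ((pow q (suc c) - 1ℚ) ⁻¹) (φ c q ⁻¹) ⟩
    1ℚ * (pow q (suc c) - 1ℚ) ⁻¹ * φ c q ⁻¹ * 1ℚ
      ≡⟨ cong (λ n → 1ℚ * (pow q n - 1ℚ) ⁻¹ * φ c q ⁻¹ * 1ℚ) (ℕP.+-identityʳ (suc c)) ⟨
    1ℚ * (pow q (suc c ℕ.+ 0) - 1ℚ) ⁻¹ * φ c q ⁻¹ * 1ℚ ∎
    where
    pad : ∀ x y → x * y ≡ 1ℚ * x * y * 1ℚ
    pad = solve-∀ ℚ-ring
  Ψ-φ⁻¹-replicate (suc k) c = begin
    φ (suc c) q ⁻¹ * Ψ (φ⁻¹ q) 0 (replicate k true) - Ψ (φ⁻¹ q) (suc c) (replicate k true)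
      ≡⟨ cong₂ (λ x y → φ (suc c) q ⁻¹ * x - y) (Ψ-φ⁻¹-replicate k 0) (Ψ-φ⁻¹-replicate k (suc c)) ⟩
    φ (suc c) q ⁻¹ * (Q * B * 1ℚ * v) - Q * (pow q (suc (suc c) ℕ.+ k) - 1ℚ) ⁻¹ * φ (suc c) q ⁻¹ * v
      ≡⟨ cong₂ (λ x y → x * (Q * B * 1ℚ * v) - Q * (y - 1ℚ) ⁻¹ * x * v)
               (⁻¹-distrib-* (r - 1ℚ) (φ c q)) qᶜ⁺ᵏ⁺²≡r*p ⟩
    A * u * (Q * B * 1ℚ * v) - Q * C * (A * u) * v
      ≡⟨ collect A B C Q u v ⟩
    Q * u * v * (A * B - C * A)
      ≡⟨ cong (Q * u * v *_) (partial-fractions r p (pow-suc-1≢0 q≢1 q≢-1 c) (pow-suc-1≢0 q≢1 q≢-1 k) r*p-1≢0) ⟩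
    Q * u * v * (p * C * B)
      ≡⟨ redistribute B C Q u v p ⟩
    p * Q * C * u * (B * v)
      ≡⟨ cong₂ (λ x y → x * (y - 1ℚ) ⁻¹ * u * (B * v)) (pow-+ q (suc k) (triangular (suc k))) r*p≡qᶜ⁺ᵏ⁺² ⟨
    pow q (triangular (suc (suc k))) * (pow q (suc c ℕ.+ suc k) - 1ℚ) ⁻¹ * u * (B * v)
      ≡⟨ cong (pow q (triangular (suc (suc k))) * (pow q (suc c ℕ.+ suc k) - 1ℚ) ⁻¹ * u *_)
              (⁻¹-distrib-* (p - 1ℚ) (φ k q)) ⟨
    pow q (triangular (suc (suc k))) * (pow q (suc c ℕ.+ suc k) - 1ℚ) ⁻¹ * φ c q ⁻¹ * φ (suc k) q ⁻¹ ∎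
    where
    Q = pow q (triangular (suc k))
    r = pow q (suc c)
    p = pow q (suc k)
    A = (r - 1ℚ) ⁻¹
    B = (p - 1ℚ) ⁻¹
    C = (r * p - 1ℚ) ⁻¹
    u = φ c q ⁻¹
    v = φ k q ⁻¹
    r*p≡qᶜ⁺ᵏ⁺² : pow q (suc c ℕ.+ suc k) ≡ r * p
    r*p≡qᶜ⁺ᵏ⁺² = pow-+ q (suc c) (suc k)
    qᶜ⁺ᵏ⁺²≡r*p : pow q (suc (suc c) ℕ.+ k) ≡ r * p
    qᶜ⁺ᵏ⁺²≡r*p = trans (cong (pow q) (sym (ℕP.+-suc (suc c) k))) r*p≡qᶜ⁺ᵏ⁺²
    r*p-1≢0 : r * p - 1ℚ ≢ 0ℚ
    r*p-1≢0 = subst (λ x → x - 1ℚ ≢ 0ℚ) r*p≡qᶜ⁺ᵏ⁺² (pow-suc-1≢0 q≢1 q≢-1 (c ℕ.+ suc k))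
    collect : ∀ A B C Q u v → A * u * (Q * B * 1ℚ * v) - Q * C * (A * u) * v ≡ Q * u * v * (A * B - C * A)
    collect = solve-∀ ℚ-ring
    redistribute : ∀ B C Q u v p → Q * u * v * (p * C * B) ≡ p * Q * C * u * (B * v)
    redistribute = solve-∀ ℚ-ring

  Ψ-φ⁻¹-interval : ∀ k → Ψ (φ⁻¹ q) 0 (replicate k true) ≡ pow q (triangular (suc k)) * φ⁻¹ q (suc k)
  Ψ-φ⁻¹-interval k = begin
    Ψ (φ⁻¹ q) 0 (replicate k true)
      ≡⟨ Ψ-φ⁻¹-replicate k 0 ⟩
    pow q (triangular (suc k)) * (pow q (suc k) - 1ℚ) ⁻¹ * 1ℚ * φ k q ⁻¹
      ≡⟨ drop-one (pow q (triangular (suc k))) _ _ ⟩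
    pow q (triangular (suc k)) * ((pow q (suc k) - 1ℚ) ⁻¹ * φ k q ⁻¹)
      ≡⟨ cong (pow q (triangular (suc k)) *_) (⁻¹-distrib-* (pow q (suc k) - 1ℚ) (φ k q)) ⟨
    pow q (triangular (suc k)) * φ⁻¹ q (suc k) ∎
    where
    drop-one : ∀ x y z → x * y * 1ℚ * z ≡ x * (y * z)
    drop-one = solve-∀ ℚ-ring

module _ {q : ℚ} (q≢0 : q ≢ 0ℚ) where

  pow-⁻¹-inverseˡ : ∀ n → pow (q ⁻¹) n * pow q n ≡ 1ℚ
  pow-⁻¹-inverseˡ zero    = refl
  pow-⁻¹-inverseˡ (suc n) = begin
    q ⁻¹ * pow (q ⁻¹) n * (q * pow q n)   ≡⟨ interchange (q ⁻¹) (pow (q ⁻¹) n) q (pow q n) ⟩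
    q ⁻¹ * q * (pow (q ⁻¹) n * pow q n)   ≡⟨ cong₂ _*_ (⁻¹-inverseˡ q≢0) (pow-⁻¹-inverseˡ n) ⟩
    1ℚ                                    ∎
    where
    interchange : ∀ a b c d → a * b * (c * d) ≡ a * c * (b * d)
    interchange = solve-∀ ℚ-ring

  φ-at-⁻¹ : ∀ n → φ n (q ⁻¹) * (pow (- q) n * pow q (triangular n)) ≡ φ n q
  φ-at-⁻¹ zero    = refl
  φ-at-⁻¹ (suc n) = begin
    (q ⁻¹ * I - 1ℚ) * F * (- q * M * pow q (n ℕ.+ triangular n))
      ≡⟨ cong (λ x → (q ⁻¹ * I - 1ℚ) * F * (- q * M * x)) (pow-+ q n (triangular n)) ⟩
    (q ⁻¹ * I - 1ℚ) * F * (- q * M * (P * T))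
      ≡⟨ expand (q ⁻¹) I F q M P T ⟩
    (- (q ⁻¹ * q * (I * P)) + q * P) * (F * (M * T))
      ≡⟨ cong₂ (λ x y → (- x + q * P) * y)
               (cong₂ _*_ (⁻¹-inverseˡ q≢0) (pow-⁻¹-inverseˡ n)) (φ-at-⁻¹ n) ⟩
    (- (1ℚ * 1ℚ) + q * P) * φ n q
      ≡⟨ tidy q P (φ n q) ⟩
    (q * P - 1ℚ) * φ n q ∎
    where
    I = pow (q ⁻¹) n
    F = φ n (q ⁻¹)
    M = pow (- q) n
    P = pow q n
    T = pow q (triangular n)
    expand : ∀ q′ I F q M P T →
      (q′ * I - 1ℚ) * F * (- q * M * (P * T)) ≡ (- (q′ * q * (I * P)) + q * P) * (F * (M * T))
    expand = solve-∀ ℚ-ring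
    tidy : ∀ q P f → (- (1ℚ * 1ℚ) + q * P) * f ≡ (q * P - 1ℚ) * f
    tidy = solve-∀ ℚ-ring

module _ {q : ℚ} (q≢0 : q ≢ 0ℚ) (q≢1 : q ≢ 1ℚ) (q≢-1 : q ≢ - 1ℚ) where

  φ⁻¹-at-⁻¹ : ∀ n → φ⁻¹ (q ⁻¹) n ≡ pow (- q) n * (pow q (triangular n) * φ⁻¹ q n)
  φ⁻¹-at-⁻¹ n = ⁻¹-unique {φ n (q ⁻¹)} (begin
    φ n (q ⁻¹) * (pow (- q) n * (pow q (triangular n) * φ⁻¹ q n))
      ≡⟨ reassociate (φ n (q ⁻¹)) (pow (- q) n) (pow q (triangular n)) (φ⁻¹ q n) ⟩
    φ n (q ⁻¹) * (pow (- q) n * pow q (triangular n)) * φ⁻¹ q n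
      ≡⟨ cong (_* φ⁻¹ q n) (φ-at-⁻¹ q≢0 n) ⟩
    φ n q * φ n q ⁻¹
      ≡⟨ ⁻¹-inverseʳ (φ≢0 q≢1 q≢-1 n) ⟩
    1ℚ ∎)
    where
    reassociate : ∀ a b c d → a * (b * (c * d)) ≡ a * (b * c) * d
    reassociate = solve-∀ ℚ-ring

  Ψ-φ⁻¹-reciprocal : ∀ {m} (K : Subset m) →
    Ψ (φ⁻¹ (q ⁻¹)) 0 (toList K) ≡ pow (- q) (suc m) * Ψ (φ⁻¹ q) 0 (toList (∁ K))
  Ψ-φ⁻¹-reciprocal {m} K = begin
    Ψ (φ⁻¹ (q ⁻¹)) 0 (toList K)
      ≡⟨ Ψ-cong φ⁻¹-at-⁻¹ 0 (toList K) ⟩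
    Ψ (λ n → pow (- q) n * t n) 0 (toList K)
      ≡⟨ Ψ-scale (- q) t 0 (toList K) ⟩
    pow (- q) (suc (length (toList K))) * Ψ t 0 (toList K)
      ≡⟨ cong₂ (λ n x → pow (- q) (suc n) * x) (length-toList K)
               (Ψ-dual (φ⁻¹ q) t (Ψ-φ⁻¹-interval q≢1 q≢-1) 0 (toList K)) ⟩
    pow (- q) (suc m) * Ψ (φ⁻¹ q) 0 (map not (toList K))
      ≡⟨ cong (λ b → pow (- q) (suc m) * Ψ (φ⁻¹ q) 0 b) (toList-map not K) ⟨
    pow (- q) (suc m) * Ψ (φ⁻¹ q) 0 (toList (∁ K)) ∎
    where
    t : ℕ → ℚ
    t n = pow q (triangular n) * φ⁻¹ q n

  w-duality : ∀ m (K : Subset m) → pow q ((suc m *ℕ m) div 2) * w (suc m) K (q ⁻¹) ≡ w (suc m) (∁ K) q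
  w-duality m K = begin
    pow q ((ℓ *ℕ m) div 2) * w ℓ K (q ⁻¹)
      ≡⟨ cong₂ (λ n x → pow q n * x) ([[1+m]*m]/2≡triangular m) (w≡φ*Ψ ℓ K (q ⁻¹)) ⟩
    pow q (triangular ℓ) * (φ ℓ (q ⁻¹) * Ψ (φ⁻¹ (q ⁻¹)) 0 (toList K))
      ≡⟨ cong (λ x → pow q (triangular ℓ) * (φ ℓ (q ⁻¹) * x)) (Ψ-φ⁻¹-reciprocal K) ⟩
    pow q (triangular ℓ) * (φ ℓ (q ⁻¹) * (pow (- q) ℓ * Ψ′))
      ≡⟨ regroup (pow q (triangular ℓ)) (φ ℓ (q ⁻¹)) (pow (- q) ℓ) Ψ′ ⟩
    φ ℓ (q ⁻¹) * (pow (- q) ℓ * pow q (triangular ℓ)) * Ψ′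
      ≡⟨ cong (_* Ψ′) (φ-at-⁻¹ q≢0 ℓ) ⟩
    φ ℓ q * Ψ′
      ≡⟨ w≡φ*Ψ ℓ (∁ K) q ⟨
    w ℓ (∁ K) q ∎
    where
    ℓ = suc m
    Ψ′ = Ψ (φ⁻¹ q) 0 (toList (∁ K))
    regroup : ∀ t f p x → t * (f * (p * x)) ≡ f * (p * t) * x
    regroup = solve-∀ ℚ-ring

proposition2p23 : (ℓ : ℕ) → 2 ≤ ℓ → (ε : ℤ) → (ε ≡ + 1 ⊎ ε ≡ -[1+ 0 ]) →
    (K : Subset (ℓ ∸ 1)) →
      (a ℓ ε K + a ℓ ε (∁ K)
        ≡ (1ℚ ⊘ (+ 3 / 1)) * ((+ ℓ / 1) * (+ (ℓ ∸ 1) / 1) * ((+ ℓ / 1) + ((+ 1 -ℤ (+ 3 *ℤ ε)) / 4))))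
      × ((q : ℚ) → q ≢ 0ℚ → q ≢ 1ℚ → q ≢ - 1ℚ →
          pow q ((ℓ *ℕ (ℓ ∸ 1)) div 2) * w ℓ K (1ℚ ⊘ q) ≡ w ℓ (∁ K) q)
-- The first identity holds for every ε, and ℓ ≥ 2 is needed only to exclude ℓ = 0.
proposition2p23 (suc m) _ ε _ K = a+a∁ m ε K , λ q q≢0 q≢1 q≢-1 → w-duality q≢0 q≢1 q≢-1 m K
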